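{- Let $H$ be an arbitrary finite abelian group, let $G:=(\mathbb{Z}/7\mathbb{Z})\times H$, and let $A:=A_0\times H$ where $A_0:=\{1 \bmod 7,\ 2\bmod 7,\ 4\bmod 7\}$. Then $\phi(A)=3$ and $|A|=3|H|$, and there do not exist $a_1,a_2\in A$ with $a_1+a_2=0$.
   Context: For subsets $B, A$ of an abelian group $G$, write $B \overset{\ast}{+} B := \{b_1+b_2 : b_1,b_2\in B,\ b_1\neq b_2\}$. A subset $B\subseteq A$ is called sum-avoiding in $A$ if $(B \overset{\ast}{+} B)\cap A=\emptyset$. For a finite set $A$, $\phi(A)$ denotes the largest cardinality of a subset $B\subseteq A$ that is sum-avoiding in $A$. -}

module Defs where

open import Level using (Level; _⊔_)
open import Algebra.Bundles using (AbelianGroup)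
open import Data.Nat using (ℕ; _≤_)
open import Data.Nat.DivMod using (_mod_)
open import Data.Fin using (Fin; toℕ)
open import Data.Product using (_×_; _,_; proj₁; proj₂; Σ; ∃-syntax)
open import Data.Sum using (_⊎_)
open import Data.List using (List; length)
open import Data.List.Relation.Unary.All using (All)
open import Data.List.Relation.Unary.Any using (Any)
open import Data.List.Relation.Unary.Unique.Setoid using (Unique)
open import Relation.Binary.Bundles using (Setoid)
open import Relation.Binary.PropositionalEquality using (_≡_)
open import Relation.Nullary using (¬_)
import Data.Fin as F

Z7 : Set
Z7 = Fin 7

_+₇_ : Z7 → Z7 → Z7
a +₇ b = (toℕ a Data.Nat.+ toℕ b) mod 7

HasCard : ∀ {c ℓ p} (S : Setoid c ℓ) → (Setoid.Carrier S → Set p) → ℕ → Set (c ⊔ ℓ ⊔ p)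
HasCard S P m =
  ∃[ xs ] (Unique S xs × All P xs
          × (∀ x → P x → Any (Setoid._≈_ S x) xs) × length xs ≡ m)

module Construction {c ℓ : Level} (H : AbelianGroup c ℓ) where
  open AbelianGroup H renaming (Carrier to Hc; _≈_ to _≈H_; _∙_ to _+H_; ε to 0H)

  Gc : Set c
  Gc = Z7 × Hc

  _≈G_ : Gc → Gc → Set ℓ
  (a , h) ≈G (b , k) = Level.Lift ℓ (a ≡ b) × (h ≈H k)

  _+G_ : Gc → Gc → Gc
  (a , h) +G (b , k) = (a +₇ b) , (h +H k)

  0G : Gc
  0G = F.zero , 0H

  G-setoid : Setoid c ℓ
  G-setoid = record
    { Carrier = Gc
    ; _≈_ = _≈G_
    ; isEquivalence = record
      { refl = λ {x} → Level.lift Relation.Binary.PropositionalEquality.refl , AbelianGroup.refl H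
      ; sym = λ { (Level.lift e , p) → Level.lift (Relation.Binary.PropositionalEquality.sym e) , AbelianGroup.sym H p }
      ; trans = λ { (Level.lift e , p) (Level.lift e' , q) →
                    Level.lift (Relation.Binary.PropositionalEquality.trans e e') , AbelianGroup.trans H p q }
      }
    }

  H-setoid : Setoid c ℓ
  H-setoid = AbelianGroup.setoid H

  InA₀ : Z7 → Set
  InA₀ x = (x ≡ F.suc F.zero) ⊎ (x ≡ F.suc (F.suc F.zero))
           ⊎ (x ≡ F.suc (F.suc (F.suc (F.suc F.zero))))

  InA : Gc → Set
  InA g = InA₀ (proj₁ g)

  SumAvoiding : List Gc → Set (c ⊔ ℓ)
  SumAvoiding B =
    ∀ b₁ b₂ → Any (b₁ ≈G_) B → Any (b₂ ≈G_) B → ¬ (b₁ ≈G b₂) → ¬ InA (b₁ +G b₂)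

  SumAvoidingSubsetOfA : List Gc → Set (c ⊔ ℓ)
  SumAvoidingSubsetOfA B = Unique G-setoid B × All InA B × SumAvoiding B

  φA≡ : ℕ → Set (c ⊔ ℓ)
  φA≡ k = (∃[ B ] (SumAvoidingSubsetOfA B × length B ≡ k))
        × (∀ B → SumAvoidingSubsetOfA B → length B ≤ k)

  cardA≡ : ℕ → Set (c ⊔ ℓ)
  cardA≡ m = HasCard G-setoid InA m

  cardH≡ : ℕ → Set (c ⊔ ℓ)
  cardH≡ n = HasCard H-setoid (λ _ → Level.Lift c Data.Unit.⊤) n
    where import Data.Unit

-- A₀ = {1, 2, 4} is the group of non-zero squares modulo 7. It is closed under
-- doubling, so two distinct elements of a sum-avoiding B ⊆ A₀ × H cannot share
-- their ℤ/7ℤ-coordinate (their sum would lie in A); hence |B| ≤ |A₀| = 3 by pigeonhole, and B = A₀ × {0}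
-- attains the bound because a + b ∉ A₀ for distinct a, b ∈ A₀. Since −1 is not
-- a square modulo 7, A₀ ∩ −A₀ = ∅, so no two elements of A sum to 0.
module Submission where

open import Defs
open import Level using (Level; lift; lower)
open import Algebra.Bundles using (AbelianGroup)
open import Data.Nat using (ℕ; _*_; _+_; _≤_; s≤s)
open import Data.Nat.Properties using (≮⇒≥)
open import Data.Fin as Fin using (Fin; zero; suc; #_)
open import Data.Fin.Properties using (pigeonhole)
open import Data.Product using (_×_; _,_; proj₁; proj₂; map₁)
open import Data.Sum using (inj₁; inj₂)
open import Data.List using (List; []; _∷_; [_]; map; length; lookup; cartesianProductWith; cartesianProduct)
open import Data.List.Properties using (length-++; length-map)
import Data.List.Relation.Unary.All as All
import Data.List.Relation.Unary.All.Properties as All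
open import Data.List.Relation.Unary.Any using (Any; here; there; index)
import Data.List.Membership.Propositional as Prop
open import Data.List.Membership.Propositional.Properties using (∈-lookup)
import Data.List.Membership.Setoid as SetoidMembership
import Data.List.Membership.Setoid.Properties as SetoidMembershipₚ
open import Data.List.Relation.Unary.Unique.Setoid using (Unique)
open import Data.List.Relation.Unary.AllPairs using ([]; _∷_)
import Data.List.Relation.Unary.Unique.Setoid.Properties as Unique
open import Relation.Binary.Bundles using (Setoid)
open import Relation.Binary.PropositionalEquality using (_≡_; _≢_; refl; trans; cong; cong₂; setoid)
open import Function using (_∘_)
open import Relation.Nullary using (¬_; contradiction)
open import Relation.Nullary.Decidable using (from-yes; False; toWitnessFalse)
open import Data.List.Relation.Unary.Unique.DecPropositional (Fin._≟_ {7}) using (unique?)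
open import Data.List.Membership.DecPropositional (Fin._≟_ {7}) using (_∈?_)

length-cartesianProductWith : ∀ {a b c} {A : Set a} {B : Set b} {C : Set c}
  (f : A → B → C) (xs : List A) (ys : List B) →
  length (cartesianProductWith f xs ys) ≡ length xs * length ys
length-cartesianProductWith f []       ys = refl
length-cartesianProductWith f (x ∷ xs) ys =
  trans (length-++ (map (f x) ys))
    (cong₂ _+_ (length-map (f x) ys) (length-cartesianProductWith f xs ys))

module _ {a ℓ} (S : Setoid a ℓ) where
  open Setoid S

  Unique-lookup-< : ∀ {xs} → Unique S xs → ∀ {i j} → i Fin.< j → ¬ lookup xs i ≈ lookup xs j
  Unique-lookup-< (x≉xs ∷ _)   {zero}  {suc j} _         = All.lookup x≉xs (∈-lookup j)
  Unique-lookup-< (_ ∷ unique) {suc i} {suc j} (s≤s i<j) = Unique-lookup-< unique i<j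

-- InA₀ is declared inside Construction H, so even the facts about A₀ alone live here.
module _ {c ℓ : Level} (H : AbelianGroup c ℓ) where
  open Construction H

  A₀ : List Z7
  A₀ = # 1 ∷ # 2 ∷ # 4 ∷ []

  InA₀⇒∈A₀ : ∀ {a} → InA₀ a → a Prop.∈ A₀
  InA₀⇒∈A₀ (inj₁ a≡1)        = here a≡1
  InA₀⇒∈A₀ (inj₂ (inj₁ a≡2)) = there (here a≡2)
  InA₀⇒∈A₀ (inj₂ (inj₂ a≡4)) = there (there (here a≡4))

  ∈A₀⇒InA₀ : ∀ {a} → a Prop.∈ A₀ → InA₀ a
  ∈A₀⇒InA₀ (here a≡1)                = inj₁ a≡1
  ∈A₀⇒InA₀ (there (here a≡2))        = inj₂ (inj₁ a≡2)
  ∈A₀⇒InA₀ (there (there (here a≡4))) = inj₂ (inj₂ a≡4)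

  Unique-A₀ : Unique (setoid Z7) A₀
  Unique-A₀ = from-yes (unique? A₀)

  InA₀-double : ∀ {a} → InA₀ a → InA₀ (a +₇ a)
  InA₀-double (inj₁ refl)        = inj₂ (inj₁ refl)
  InA₀-double (inj₂ (inj₁ refl)) = inj₂ (inj₂ refl)
  InA₀-double (inj₂ (inj₂ refl)) = inj₁ refl

  ¬InA₀ : ∀ {a} → False (a ∈? A₀) → ¬ InA₀ a
  ¬InA₀ a∉A₀ = toWitnessFalse a∉A₀ ∘ InA₀⇒∈A₀

  InA₀-sumFree : ∀ {a b} → InA₀ a → InA₀ b → a ≢ b → ¬ InA₀ (a +₇ b)
  InA₀-sumFree (inj₁ refl)        (inj₁ refl)        a≢a = contradiction refl a≢a
  InA₀-sumFree (inj₁ refl)        (inj₂ (inj₁ refl)) _   = ¬InA₀ _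
  InA₀-sumFree (inj₁ refl)        (inj₂ (inj₂ refl)) _   = ¬InA₀ _
  InA₀-sumFree (inj₂ (inj₁ refl)) (inj₁ refl)        _   = ¬InA₀ _
  InA₀-sumFree (inj₂ (inj₁ refl)) (inj₂ (inj₁ refl)) a≢a = contradiction refl a≢a
  InA₀-sumFree (inj₂ (inj₁ refl)) (inj₂ (inj₂ refl)) _   = ¬InA₀ _
  InA₀-sumFree (inj₂ (inj₂ refl)) (inj₁ refl)        _   = ¬InA₀ _
  InA₀-sumFree (inj₂ (inj₂ refl)) (inj₂ (inj₁ refl)) _   = ¬InA₀ _
  InA₀-sumFree (inj₂ (inj₂ refl)) (inj₂ (inj₂ refl)) a≢a = contradiction refl a≢a

  InA₀-sum≢0 : ∀ {a b} → InA₀ a → InA₀ b → a +₇ b ≢ zero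
  InA₀-sum≢0 (inj₁ refl)        (inj₁ refl)        ()
  InA₀-sum≢0 (inj₁ refl)        (inj₂ (inj₁ refl)) ()
  InA₀-sum≢0 (inj₁ refl)        (inj₂ (inj₂ refl)) ()
  InA₀-sum≢0 (inj₂ (inj₁ refl)) (inj₁ refl)        ()
  InA₀-sum≢0 (inj₂ (inj₁ refl)) (inj₂ (inj₁ refl)) ()
  InA₀-sum≢0 (inj₂ (inj₁ refl)) (inj₂ (inj₂ refl)) ()
  InA₀-sum≢0 (inj₂ (inj₂ refl)) (inj₁ refl)        ()
  InA₀-sum≢0 (inj₂ (inj₂ refl)) (inj₂ (inj₁ refl)) ()
  InA₀-sum≢0 (inj₂ (inj₂ refl)) (inj₂ (inj₂ refl)) ()

  open AbelianGroup H using () renaming (Carrier to Hc; _≈_ to _≈H_; ε to 0H)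
  open Setoid H-setoid using () renaming (sym to ≈H-sym; trans to ≈H-trans)
  open SetoidMembership G-setoid using (_∈_)

  InA-resp-≈G : ∀ {x y} → x ≈G y → InA x → InA y
  InA-resp-≈G (lift refl , _) x∈A = x∈A

  SumAvoiding⇒residues-distinct : ∀ {B x y} → SumAvoiding B → x ∈ B → y ∈ B →
                                  ¬ x ≈G y → InA x → proj₁ x ≢ proj₁ y
  SumAvoiding⇒residues-distinct {x = _ , _} {y = _ , _} avoiding x∈B y∈B x≉y x∈A refl =
    avoiding _ _ x∈B y∈B x≉y (InA₀-double x∈A)

  residue-injective⇒SumAvoiding : ∀ {B} → All.All InA B →
    (∀ {x y} → x ∈ B → y ∈ B → proj₁ x ≡ proj₁ y → x ≈G y) → SumAvoiding B
  residue-injective⇒SumAvoiding {B} B⊆A residue-injective x y x∈B y∈B x≉y =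
    InA₀-sumFree (∈B⇒InA x∈B) (∈B⇒InA y∈B) (x≉y ∘ residue-injective x∈B y∈B)
    where
    ∈B⇒InA : ∀ {x} → x ∈ B → InA x
    ∈B⇒InA = All.lookupₛ G-setoid InA-resp-≈G B⊆A

  residueIndex : ∀ {B} → All.All InA B → Fin (length B) → Fin 3
  residueIndex B⊆A i = index (InA₀⇒∈A₀ (All.lookup B⊆A (∈-lookup i)))

  SumAvoidingSubsetOfA⇒length≤3 : ∀ {B} → SumAvoidingSubsetOfA B → length B ≤ 3
  SumAvoidingSubsetOfA⇒length≤3 {B} (unique , B⊆A , avoiding) = ≮⇒≥ λ 3<|B| →
    let i , j , i<j , sameIndex = pigeonhole 3<|B| (residueIndex B⊆A) in
    SumAvoiding⇒residues-distinct avoiding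
      (SetoidMembershipₚ.∈-lookup G-setoid B i) (SetoidMembershipₚ.∈-lookup G-setoid B j)
      (Unique-lookup-< G-setoid unique i<j) (All.lookup B⊆A (∈-lookup i))
      (SetoidMembershipₚ.index-injective (setoid Z7) _ _ sameIndex)

  A₀×_ : List Hc → List Gc
  A₀× hs = cartesianProduct A₀ hs

  A₀×-⊆A : ∀ hs → All.All InA (A₀× hs)
  A₀×-⊆A hs = All.cartesianProduct⁺ (setoid Z7) H-setoid A₀ hs (λ a∈A₀ _ → ∈A₀⇒InA₀ a∈A₀)

  A₀×-unique : ∀ {hs} → Unique H-setoid hs → Unique G-setoid (A₀× hs)
  A₀×-unique = Unique.cartesianProductWith⁺ (setoid Z7) H-setoid G-setoid _,_ (map₁ lower) Unique-A₀

  A₀×-complete : ∀ {hs} → (∀ h → Any (h ≈H_) hs) → ∀ x → InA x → x ∈ A₀× hs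
  A₀×-complete covers (a , h) a∈A₀ =
    SetoidMembershipₚ.∈-cartesianProductWith⁺ (setoid Z7) H-setoid G-setoid
      (λ a≡b h≈k → lift a≡b , h≈k) (InA₀⇒∈A₀ a∈A₀) (covers h)

  A₀×-length : ∀ hs → length (A₀× hs) ≡ 3 * length hs
  A₀×-length = length-cartesianProductWith _,_ A₀

  A₀×[h]-residue-injective : ∀ {h x y} → x ∈ A₀× [ h ] → y ∈ A₀× [ h ] →
                            proj₁ x ≡ proj₁ y → x ≈G y
  A₀×[h]-residue-injective {h} x∈ y∈ x₁≡y₁ =
    lift x₁≡y₁ , ≈H-trans (second≈h x∈) (≈H-sym (second≈h y∈))
    where
    second≈h : ∀ {x} → x ∈ A₀× [ h ] → proj₂ x ≈H h
    second≈h x∈ with SetoidMembershipₚ.∈-cartesianProductWith⁻ (setoid Z7) H-setoid G-setoid _,_ A₀ [ h ] x∈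
    ... | _ , _ , _ , here k≈h , (_ , x₂≈k) = ≈H-trans x₂≈k k≈h

  φA≡3 : φA≡ 3
  φA≡3 = (A₀× [ 0H ] , (unique , A₀×-⊆A [ 0H ] , avoiding) , refl)
       , λ _ → SumAvoidingSubsetOfA⇒length≤3
    where
    unique : Unique G-setoid (A₀× [ 0H ])
    unique = A₀×-unique (All.[] ∷ [])
    avoiding : SumAvoiding (A₀× [ 0H ])
    avoiding = residue-injective⇒SumAvoiding (A₀×-⊆A [ 0H ]) A₀×[h]-residue-injective

  cardH⇒cardA : ∀ {n} → cardH≡ n → cardA≡ (3 * n)
  cardH⇒cardA (hs , unique , _ , covers , |hs|≡n) =
    A₀× hs , A₀×-unique unique , A₀×-⊆A hs , A₀×-complete (λ h → covers h _) ,
    trans (A₀×-length hs) (cong (3 *_) |hs|≡n)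

  A-sum≉0 : ∀ a₁ a₂ → InA a₁ → InA a₂ → ¬ (a₁ +G a₂) ≈G 0G
  A-sum≉0 _ _ a₁∈A a₂∈A (lift sum≡0 , _) = InA₀-sum≢0 a₁∈A a₂∈A sum≡0

proposition4p3 : {c ℓ : Level} (H : AbelianGroup c ℓ) (n : ℕ) →
    Construction.cardH≡ H n →
    Construction.φA≡ H 3
    × Construction.cardA≡ H (3 * n)
    × (∀ a₁ a₂ → Construction.InA H a₁ → Construction.InA H a₂ →
         ¬ Construction._≈G_ H (Construction._+G_ H a₁ a₂) (Construction.0G H))
proposition4p3 H n cardH = φA≡3 H , cardH⇒cardA H cardH , A-sum≉0 H
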